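{- Let $n\ge 1$ and $0\le i\le n$, and let $P_i$ be the set of stable $n$-subsets of $[2n+2]$ having exactly $i$ even elements and $n-i$ odd elements. Put $\alpha^0:=\{1,3,\dots,2(n-i)-1,\,2(n-i)+2,\dots,2n\}$ and $\alpha^j:=\alpha^0\ominus 2j$ for $j=1,\dots,n$. Then $P_i=\{\alpha^0,\dots,\alpha^n\}$, the sequence $\alpha^0,\alpha^1,\dots,\alpha^n$ lists $P_i$ in lexicographic order, and $\alpha^n\ominus 2=\alpha^0$.
   Context: Arithmetic on $[2n+2]$ is modulo $2n+2$ with representatives in $[2n+2]$. An $n$-subset of $[2n+2]$ is stable if it contains no two cyclically consecutive elements ($\{i,i+1\}$ for $1\le i\le 2n+1$, or $\{1,2n+2\}$). For a set $\alpha=\{\alpha_1,\dots,\alpha_n\}$ and integer $j$, $\alpha\ominus j:=\{\alpha_1-j,\dots,\alpha_n-j\}$. Lexicographic order compares sets as increasingly sorted sequences. -}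

module Defs where

open import Data.Nat using (ℕ; zero; suc; _+_; _*_; _∸_; _≤_; _<_)
open import Data.Nat.Properties using (≤-decTotalOrder; <-strictTotalOrder)
open import Data.Nat.DivMod using (_%_)
open import Data.Nat.Divisibility using (_∣_; _∣?_)
open import Data.List using (List; []; _∷_; map; _++_; length; filter; upTo)
open import Data.List.Membership.Propositional using (_∈_)
open import Data.List.Relation.Unary.All using (All)
open import Data.List.Relation.Unary.Linked using (Linked)
open import Data.List.Relation.Binary.Lex.Strict using (Lex-<)
open import Data.Product using (_×_)
open import Relation.Binary.PropositionalEquality using (_≡_)
open import Relation.Nullary using (¬_; ¬?)
import Data.List.Sort as Sort
open Sort ≤-decTotalOrder using (sort)

-- Finite subsets of ℕ are represented canonically as strictly increasing
-- lists (the "increasingly sorted sequence" of the set).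

M : ℕ → ℕ
M n = suc (suc (2 * n))

-- x ⊖ j in [2n+2]: the representative in {1,…,2n+2} of x - j mod (2n+2).
-- (For x ≥ 1, x + M*j - j - 1 ≥ 0 and is ≡ x - j - 1 mod M.)
shiftElt : ℕ → ℕ → ℕ → ℕ
shiftElt n j x = suc ((x + M n * j ∸ j ∸ 1) % M n)

shiftSet : ℕ → List ℕ → ℕ → List ℕ
shiftSet n α j = sort (map (shiftElt n j) α)

CycConsec : ℕ → ℕ → ℕ → Set
CycConsec n x y = (y ≡ suc x) × (1 ≤ x) × (x ≤ 2 * n + 1)

IsStable : ℕ → List ℕ → Set
IsStable n β =
  Linked _<_ β
  × All (λ x → 1 ≤ x × x ≤ M n) β
  × length β ≡ n
  × (∀ {x y} → x ∈ β → y ∈ β → ¬ CycConsec n x y)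
  × ¬ (1 ∈ β × M n ∈ β)

evenCount : List ℕ → ℕ
evenCount β = length (filter (2 ∣?_) β)

InP : ℕ → ℕ → List ℕ → Set
InP n i β = IsStable n β × evenCount β ≡ i × length (filter (λ x → ¬? (2 ∣? x)) β) ≡ n ∸ i

alpha0 : ℕ → ℕ → List ℕ
alpha0 n i = map (λ k → 2 * k + 1) (upTo (n ∸ i))
          ++ map (λ k → 2 * (n ∸ i) + 2 + 2 * k) (upTo i)

alpha : ℕ → ℕ → ℕ → List ℕ
alpha n i j = shiftSet n (alpha0 n i) (2 * j)

LexLt : List ℕ → List ℕ → Set
LexLt = Lex-< _≡_ _<_

module Submission where

-- List a set with no two consecutive elements increasingly as
-- b₀ < b₁ < … and write b_k = 2k+1+e_k.  Consecutive entries differ by at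
-- least 2 exactly when the "slacks" e_k are non-decreasing, and for an
-- n-subset of [2n+2] the last entry forces e_k ≤ 3.  So a stable n-subset is
-- determined by its slack word 0^c₀ 1^c₁ 2^c₂ 3^c₃ (its "configuration");
-- its even elements are those of odd slack (c₁ + c₃ of them), and it avoids
-- containing both 1 and 2n+2 iff c₀ = 0 or c₃ = 0.  Hence P_i is the set of
-- configurations with c₀+c₁+c₂+c₃ = n, c₁+c₃ = i and c₀c₃ = 0.
--
-- On the other side α⁰ is the configuration (n-i, i, 0, 0), and x ↦ x ⊖ d
-- moves each run of equal slacks rigidly (possibly wrapping past 2n+2).
-- Therefore αʲ = (n-i-j, i, j, 0) for j ≤ n-i and αʲ = (0, n-j, n-i, j-n+i)
-- for j ≥ n-i: exactly the admissible configurations.  Consecutive ones grow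
-- lexicographically since the first slack that changes increases, and
-- αⁿ ⊖ 2 = α⁰ is one more rigid shift.

open import Defs
open import Data.Nat using (ℕ; suc; _≤_; _<_)
open import Data.List using (List)
open import Data.Product using (_×_; ∃-syntax)
open import Relation.Binary.PropositionalEquality using (_≡_)

open import Data.Nat using (zero; _+_; _*_; _∸_; z≤n; s≤s; _≟_; _≤?_)
open import Data.Nat.Properties
open import Data.Nat.DivMod using (_%_; [m+kn]%n≡m%n; m<n⇒m%n≡m)
open import Data.Nat.Divisibility using (_∣_; _∣?_; divides; ∣m+n∣m⇒∣n; >⇒∤; m∣m*n)
open import Data.Nat.Tactic.RingSolver using (solve; solve-∀)
import Data.List as L
open import Data.List using ([]; _∷_; _++_; map; length; filter; replicate; applyUpTo; upTo)
open import Data.List.Properties using (length-replicate; length-++; map-++; map-applyUpTo; filter-all; filter-none; filter-++; ++-identityʳ; ++-assoc)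
open import Data.List.Membership.Propositional using (_∈_)
open import Data.List.Membership.Propositional.Properties using (∈-++⁺ʳ)
open import Data.List.Relation.Unary.Any using (here; there)
open import Data.List.Relation.Unary.All as All using (All; []; _∷_)
import Data.List.Relation.Unary.All.Properties as AllP
open import Data.List.Relation.Unary.Linked as Linked using (Linked; []; [-]; _∷_)
open import Data.List.Relation.Unary.Linked.Properties using (Linked⇒All)
open import Data.List.Relation.Binary.Lex.Strict using (Lex-<)
open import Data.List.Relation.Binary.Lex.Core using (base; halt; this; next)
open import Data.List.Relation.Binary.Permutation.Propositional using (_↭_; ↭⇒↭ₛ; ↭-trans; ↭-reflexive)
import Data.List.Relation.Binary.Permutation.Propositional.Properties as Perm
open import Data.List.Relation.Unary.Sorted.TotalOrder.Properties using (↗↭↗⇒≋)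
open import Data.List.Relation.Binary.Pointwise using (Pointwise-≡⇒≡)
import Data.List.Sort as Sort
open Sort ≤-decTotalOrder using (sort; sort-↭; sort-↗)
open import Data.Product using (_,_; proj₁; proj₂)
open import Data.Sum using (_⊎_; inj₁; inj₂)
open import Data.Empty using (⊥-elim)
open import Function using (_∘_)
open import Relation.Binary using (Transitive)
open import Relation.Binary.PropositionalEquality using (refl; sym; trans; cong; cong₂; subst; subst₂; _≢_; module ≡-Reasoning)
open import Relation.Nullary using (¬_; yes; no; ¬?)
open import Relation.Unary using (Decidable)

-- Slots and configurations

-- The smallest value at position k (counted from 0) is 2k+1; a slack e
-- places the entry at 2k+1+e.
slot : ℕ → ℕ → ℕ
slot k e = 2 * k + 1 + e

slot-suc : ∀ k e → slot (suc k) e ≡ 2 + slot k e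
slot-suc k e = cong (λ x → x + 1 + e) (*-suc 2 k)

slot-carry : ∀ k e → slot k (2 + e) ≡ slot (suc k) e
slot-carry k e = trans (trans (+-suc (2 * k + 1) (suc e)) (cong suc (+-suc (2 * k + 1) e))) (sym (slot-suc k e))

slot-pos : ∀ k e → 1 ≤ slot k e
slot-pos k e = ≤-trans (m≤n+m 1 (2 * k)) (m≤m+n (2 * k + 1) e)

slot-fits : ∀ {n k e} → k < n → e ≤ 3 → slot k e ≤ M n
slot-fits {n} {k} {e} k<n e≤3 = begin
  2 * k + 1 + e  ≤⟨ +-monoʳ-≤ (2 * k + 1) e≤3 ⟩
  2 * k + 1 + 3  ≡⟨ solve (k L.∷ L.[]) ⟩
  2 + 2 * suc k  ≤⟨ +-monoʳ-≤ 2 (*-monoʳ-≤ 2 k<n) ⟩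
  2 + 2 * n      ∎
  where open ≤-Reasoning

slotted : ℕ → List ℕ → List ℕ
slotted k []       = []
slotted k (e ∷ es) = slot k e ∷ slotted (suc k) es

run : ℕ → ℕ → ℕ → List ℕ
run k c e = slotted k (replicate c e)

slackWord : ℕ → ℕ → ℕ → ℕ → List ℕ
slackWord c₀ c₁ c₂ c₃ = replicate c₀ 0 ++ replicate c₁ 1 ++ replicate c₂ 2 ++ replicate c₃ 3

config : ℕ → ℕ → ℕ → ℕ → List ℕ
config c₀ c₁ c₂ c₃ = slotted 0 (slackWord c₀ c₁ c₂ c₃)

length-slotted : ∀ k es → length (slotted k es) ≡ length es
length-slotted k []       = refl
length-slotted k (e ∷ es) = cong suc (length-slotted (suc k) es)

length-run : ∀ k c e → length (run k c e) ≡ c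
length-run k c e = trans (length-slotted k (replicate c e)) (length-replicate c)

length-slackWord : ∀ c₀ c₁ c₂ c₃ → length (slackWord c₀ c₁ c₂ c₃) ≡ c₀ + c₁ + c₂ + c₃
length-slackWord c₀ c₁ c₂ c₃ = begin
  length (slackWord c₀ c₁ c₂ c₃)                         ≡⟨ block c₀ 0 ⟩
  c₀ + length (replicate c₁ 1 ++ replicate c₂ 2 ++ replicate c₃ 3)
                                                         ≡⟨ cong (c₀ +_) (block c₁ 1) ⟩
  c₀ + (c₁ + length (replicate c₂ 2 ++ replicate c₃ 3))  ≡⟨ cong (λ l → c₀ + (c₁ + l)) (block c₂ 2) ⟩
  c₀ + (c₁ + (c₂ + length (replicate c₃ 3)))             ≡⟨ cong (λ l → c₀ + (c₁ + (c₂ + l))) (length-replicate c₃) ⟩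
  c₀ + (c₁ + (c₂ + c₃))                                  ≡⟨ solve (c₀ L.∷ c₁ L.∷ c₂ L.∷ c₃ L.∷ L.[]) ⟩
  c₀ + c₁ + c₂ + c₃                                      ∎
  where
  open ≡-Reasoning
  block : ∀ c v {ys : List ℕ} → length (replicate c v ++ ys) ≡ c + length ys
  block c v {ys} = trans (length-++ (replicate c v)) (cong (_+ length ys) (length-replicate c))

length-config : ∀ c₀ c₁ c₂ c₃ → length (config c₀ c₁ c₂ c₃) ≡ c₀ + c₁ + c₂ + c₃
length-config c₀ c₁ c₂ c₃ = trans (length-slotted 0 (slackWord c₀ c₁ c₂ c₃)) (length-slackWord c₀ c₁ c₂ c₃)

run-++ : ∀ k c e ys → slotted k (replicate c e ++ ys) ≡ run k c e ++ slotted (k + c) ys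
run-++ k zero    e ys = cong (λ p → slotted p ys) (sym (+-identityʳ k))
run-++ k (suc c) e ys = cong (slot k e ∷_)
  (trans (run-++ (suc k) c e ys) (cong (λ p → run (suc k) c e ++ slotted p ys) (sym (+-suc k c))))

run-split : ∀ k a b e → run k (a + b) e ≡ run k a e ++ run (k + a) b e
run-split k zero    b e = cong (λ p → run p b e) (sym (+-identityʳ k))
run-split k (suc a) b e = cong (slot k e ∷_)
  (trans (run-split (suc k) a b e) (cong (λ p → run (suc k) a e ++ run p b e) (sym (+-suc k a))))

config-runs : ∀ c₀ c₁ c₂ c₃ → config c₀ c₁ c₂ c₃ ≡
  run 0 c₀ 0 ++ run c₀ c₁ 1 ++ run (c₀ + c₁) c₂ 2 ++ run (c₀ + c₁ + c₂) c₃ 3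
config-runs c₀ c₁ c₂ c₃ = begin
  config c₀ c₁ c₂ c₃
    ≡⟨ run-++ 0 c₀ 0 _ ⟩
  run 0 c₀ 0 ++ slotted c₀ (replicate c₁ 1 ++ replicate c₂ 2 ++ replicate c₃ 3)
    ≡⟨ cong (run 0 c₀ 0 ++_) (run-++ c₀ c₁ 1 _) ⟩
  run 0 c₀ 0 ++ run c₀ c₁ 1 ++ slotted (c₀ + c₁) (replicate c₂ 2 ++ replicate c₃ 3)
    ≡⟨ cong (λ r → run 0 c₀ 0 ++ run c₀ c₁ 1 ++ r) (run-++ (c₀ + c₁) c₂ 2 _) ⟩
  run 0 c₀ 0 ++ run c₀ c₁ 1 ++ run (c₀ + c₁) c₂ 2 ++ run (c₀ + c₁ + c₂) c₃ 3 ∎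
  where open ≡-Reasoning

-- Sortedness

-- y lies at least two above x: the relation between consecutive entries of
-- a set without two consecutive elements.
_≪_ : ℕ → ℕ → Set
x ≪ y = 2 + x ≤ y

≪-trans : Transitive _≪_
≪-trans {_} {y} x≪y y≪z = ≤-trans x≪y (≤-trans (m≤n+m y 2) y≪z)

≪⇒< : ∀ {x y} → x ≪ y → x < y
≪⇒< {x} = ≤-trans (n≤1+n (suc x))

≪⇒≤ : ∀ {x y} → x ≪ y → x ≤ y
≪⇒≤ {x} = ≤-trans (m≤n+m x 2)

≪-head : ∀ {h t} → Linked _≪_ (h ∷ t) → All (h ≪_) t
≪-head [-]            = []
≪-head (h≪h′ ∷ chain) = Linked⇒All ≪-trans h≪h′ chain

slot-≪ : ∀ k {e e′} → e ≤ e′ → slot k e ≪ slot (suc k) e′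
slot-≪ k {e} {e′} e≤e′ =
  subst (2 + slot k e ≤_) (sym (slot-suc k e′)) (+-monoʳ-≤ 2 (+-monoʳ-≤ (2 * k + 1) e≤e′))

≪-slot : ∀ k {e e′} → slot k e ≪ slot (suc k) e′ → e ≤ e′
≪-slot k {e} {e′} spread =
  +-cancelˡ-≤ (2 * k + 1) e e′ (+-cancelˡ-≤ 2 _ _ (subst (2 + slot k e ≤_) (slot-suc k e′) spread))

slotted-≪ : ∀ k es → Linked _≤_ es → Linked _≪_ (slotted k es)
slotted-≪ k []            _          = []
slotted-≪ k (e ∷ [])      _          = [-]
slotted-≪ k (e ∷ e′ ∷ es) (e≤e′ ∷ s) = slot-≪ k e≤e′ ∷ slotted-≪ (suc k) (e′ ∷ es) s

≪-slotted : ∀ k es → Linked _≪_ (slotted k es) → Linked _≤_ es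
≪-slotted k []            _              = []
≪-slotted k (e ∷ [])      _              = [-]
≪-slotted k (e ∷ e′ ∷ es) (spread ∷ chain) = ≪-slot k spread ∷ ≪-slotted (suc k) (e′ ∷ es) chain

replicate-++-sorted : ∀ c v {ys} → All (v ≤_) ys → Linked _≤_ ys → Linked _≤_ (replicate c v ++ ys)
replicate-++-sorted zero          v _         s = s
replicate-++-sorted (suc zero)    v []        s = [-]
replicate-++-sorted (suc zero)    v (v≤y ∷ _) s = v≤y ∷ s
replicate-++-sorted (suc (suc c)) v above     s = ≤-refl ∷ replicate-++-sorted (suc c) v above s

replicate-All : ∀ {Q : ℕ → Set} c {v} → (0 < c → Q v) → All Q (replicate c v)
replicate-All zero    _  = []
replicate-All (suc c) Qv = Qv (s≤s z≤n) ∷ replicate-All c (λ _ → Qv (s≤s z≤n))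

slackWord-All : ∀ {Q : ℕ → Set} c₀ c₁ c₂ c₃ → (0 < c₀ → Q 0) → Q 1 → Q 2 → (0 < c₃ → Q 3) →
                All Q (slackWord c₀ c₁ c₂ c₃)
slackWord-All c₀ c₁ c₂ c₃ Q0 Q1 Q2 Q3 = AllP.++⁺ (replicate-All c₀ Q0)
  (AllP.++⁺ (replicate-All c₁ (λ _ → Q1)) (AllP.++⁺ (replicate-All c₂ (λ _ → Q2)) (replicate-All c₃ Q3)))

slackWord-sorted : ∀ c₀ c₁ c₂ c₃ → Linked _≤_ (slackWord c₀ c₁ c₂ c₃)
slackWord-sorted c₀ c₁ c₂ c₃ =
  replicate-++-sorted c₀ 0 (slackWord-All 0 c₁ c₂ c₃ (λ ()) z≤n z≤n (λ _ → z≤n))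
  (replicate-++-sorted c₁ 1 (slackWord-All 0 0 c₂ c₃ (λ ()) ≤-refl (s≤s z≤n) (λ _ → s≤s z≤n))
  (replicate-++-sorted c₂ 2 (replicate-All c₃ (λ _ → s≤s (s≤s z≤n)))
  (replicate-sorted c₃)))
  where
  replicate-sorted : ∀ c → Linked _≤_ (replicate c 3)
  replicate-sorted zero          = []
  replicate-sorted (suc zero)    = [-]
  replicate-sorted (suc (suc c)) = ≤-refl ∷ replicate-sorted (suc c)

config-≪ : ∀ c₀ c₁ c₂ c₃ → Linked _≪_ (config c₀ c₁ c₂ c₃)
config-≪ c₀ c₁ c₂ c₃ = slotted-≪ 0 _ (slackWord-sorted c₀ c₁ c₂ c₃)

config-sorted : ∀ c₀ c₁ c₂ c₃ → Linked _≤_ (config c₀ c₁ c₂ c₃)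
config-sorted c₀ c₁ c₂ c₃ = Linked.map ≪⇒≤ (config-≪ c₀ c₁ c₂ c₃)

-- The action of ⊖ on slots

wraps≤shift : ∀ n d a {x y} → 1 ≤ x → y ≤ M n → x + M n * a ≡ y + d → a ≤ d
wraps≤shift n d a {x} {y} 1≤x y≤M congruent = ≮⇒≥ λ d<a → <-irrefl (sym congruent) (begin-strict
  y + d          ≤⟨ +-monoˡ-≤ d y≤M ⟩
  M n + d        ≤⟨ +-monoʳ-≤ (M n) (m≤n*m d (M n)) ⟩
  M n + M n * d  ≡⟨ sym (*-suc (M n) d) ⟩
  M n * suc d    ≤⟨ *-monoʳ-≤ (M n) d<a ⟩
  M n * a        <⟨ m<n+m (M n * a) 1≤x ⟩
  x + M n * a    ∎)
  where open ≤-Reasoning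

shiftElt-char : ∀ n d a {x y} → 1 ≤ x → 1 ≤ y → y ≤ M n → x + M n * a ≡ y + d → shiftElt n d x ≡ y
shiftElt-char n d a {x} {suc y} 1≤x _ y<M congruent = begin
  suc ((x + M n * d ∸ d ∸ 1) % M n)               ≡⟨ cong (λ z → suc ((z ∸ d ∸ 1) % M n)) unwrap ⟩
  suc ((suc y + (d ∸ a) * M n + d ∸ d ∸ 1) % M n) ≡⟨ cong (λ z → suc ((z ∸ 1) % M n)) (m+n∸n≡m _ d) ⟩
  suc ((y + (d ∸ a) * M n) % M n)                 ≡⟨ cong suc ([m+kn]%n≡m%n y (d ∸ a) (M n)) ⟩
  suc (y % M n)                                   ≡⟨ cong suc (m<n⇒m%n≡m y<M) ⟩
  suc y                                           ∎
  where
  open ≡-Reasoning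
  regroup : ∀ x m a b → x + m * (a + b) ≡ x + m * a + b * m
  regroup = solve-∀
  swap : ∀ u v w → u + v + w ≡ u + w + v
  swap = solve-∀
  unwrap : x + M n * d ≡ suc y + (d ∸ a) * M n + d
  unwrap = begin
    x + M n * d                 ≡⟨ cong (λ z → x + M n * z) (sym (m+[n∸m]≡n (wraps≤shift n d a 1≤x y<M congruent))) ⟩
    x + M n * (a + (d ∸ a))     ≡⟨ regroup x (M n) a (d ∸ a) ⟩
    x + M n * a + (d ∸ a) * M n ≡⟨ cong (_+ (d ∸ a) * M n) congruent ⟩
    suc y + d + (d ∸ a) * M n   ≡⟨ swap (suc y) d ((d ∸ a) * M n) ⟩
    suc y + (d ∸ a) * M n + d   ∎

shift-run : ∀ n d a {k k′ e e′} c → e′ ≤ 3 → k′ + c ≤ n →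
            2 * k + 1 + e + (2 + 2 * n) * a ≡ 2 * k′ + 1 + e′ + d →
            map (shiftElt n d) (run k c e) ≡ run k′ c e′
shift-run n d a zero _ _ _ = refl
shift-run n d a {k} {k′} {e} {e′} (suc c) e′≤3 fits first =
  cong₂ _∷_ (shiftElt-char n d a (slot-pos k e) (slot-pos k′ e′) (slot-fits k′<n e′≤3) first)
            (shift-run n d a c e′≤3 fits′ following)
  where
  fits′ : suc k′ + c ≤ n
  fits′ = subst (_≤ n) (+-suc k′ c) fits
  k′<n : k′ < n
  k′<n = ≤-trans (s≤s (m≤m+n k′ c)) fits′
  following : slot (suc k) e + M n * a ≡ slot (suc k′) e′ + d
  following = trans (cong (_+ M n * a) (slot-suc k e))
               (trans (cong (2 +_) first) (cong (_+ d) (sym (slot-suc k′ e′))))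

≤-by : ∀ {x y} r → x + r ≡ y → x ≤ y
≤-by {x} r refl = m≤m+n x r

-- Sorting a permutation of a sorted list returns that list; this turns the
-- run-by-run description of β ⊖ d into an equality with a configuration.
sort-unique : ∀ xs ys → xs ↭ ys → Linked _≤_ ys → sort xs ≡ ys
sort-unique xs ys xs↭ys sorted =
  Pointwise-≡⇒≡ (↗↭↗⇒≋ ≤-totalOrder (sort-↗ xs) sorted (↭⇒↭ₛ (↭-trans (sort-↭ xs) xs↭ys)))

map-++₃ : ∀ (f : ℕ → ℕ) {xs ys zs xs′ ys′ zs′} → map f xs ≡ xs′ → map f ys ≡ ys′ → map f zs ≡ zs′ →
          map f (xs ++ ys ++ zs) ≡ xs′ ++ ys′ ++ zs′
map-++₃ f {xs} {ys} {zs} fxs fys fzs =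
  trans (map-++ f xs (ys ++ zs)) (cong₂ _++_ fxs (trans (map-++ f ys zs) (cong₂ _++_ fys fzs)))

-- Configurations are stable sets

slotted-All : ∀ {P Q : ℕ → Set} n k es → k + length es ≤ n →
              (∀ {p e} → p < n → Q e → P (slot p e)) → All Q es → All P (slotted k es)
slotted-All n k []       _    _    _           = []
slotted-All n k (e ∷ es) fits slot⇒ (Qe ∷ Qes) =
  slot⇒ (≤-trans (s≤s (m≤m+n k (length es))) fits′) Qe ∷ slotted-All n (suc k) es fits′ slot⇒ Qes
  where
  fits′ : suc k + length es ≤ n
  fits′ = subst (_≤ n) (+-suc k (length es)) fits

run-All : ∀ {P : ℕ → Set} k c e → (∀ p → P (slot p e)) → All P (run k c e)
run-All k zero    e P-slot = []
run-All k (suc c) e P-slot = P-slot k ∷ run-All (suc k) c e P-slot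

≪-no-successor : ∀ {xs x y} → Linked _≪_ xs → x ∈ xs → y ∈ xs → y ≢ suc x
≪-no-successor {h ∷ t} chain       (here refl) (here refl) ()
≪-no-successor {h ∷ t} chain       (here refl) (there y∈t) refl = n≮n (suc h) (All.lookup (≪-head chain) y∈t)
≪-no-successor {h ∷ t} chain       (there x∈t) (here refl) refl =
  n≮n _ (≤-trans (m≤n+m _ 2) (All.lookup (≪-head chain) x∈t))
≪-no-successor {h ∷ t} (_ ∷ chain) (there x∈t) (there y∈t) = ≪-no-successor chain x∈t y∈t

config-avoids-ends : ∀ c₀ c₁ c₂ c₃ → c₀ ≡ 0 ⊎ c₃ ≡ 0 →
                     ¬ (1 ∈ config c₀ c₁ c₂ c₃ × M (c₀ + c₁ + c₂ + c₃) ∈ config c₀ c₁ c₂ c₃)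
config-avoids-ends c₀ c₁ c₂ c₃ (inj₁ refl) (1∈ , _) = n≮n 1 (All.lookup above 1∈)
  where
  above : All (2 ≤_) (config 0 c₁ c₂ c₃)
  above = slotted-All _ 0 _ ≤-refl (λ {p} {e} _ 1≤e → ≤-trans (s≤s 1≤e) (+-monoˡ-≤ e (m≤n+m 1 (2 * p))))
            (slackWord-All 0 c₁ c₂ c₃ (λ ()) ≤-refl (s≤s z≤n) (λ _ → s≤s z≤n))
config-avoids-ends c₀ c₁ c₂ c₃ (inj₂ refl) (_ , top∈) = n≮n _ (All.lookup below top∈)
  where
  n : ℕ
  n = c₀ + c₁ + c₂ + 0
  below : All (_< M n) (config c₀ c₁ c₂ 0)
  below = slotted-All n 0 _ (≤-reflexive (length-slackWord c₀ c₁ c₂ 0))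
            (λ {p} {e} p<n e≤2 → ≤-trans (≤-reflexive (sym (+-suc (2 * p + 1) e))) (slot-fits p<n (s≤s e≤2)))
            (slackWord-All c₀ c₁ c₂ 0 (λ _ → z≤n) (s≤s z≤n) ≤-refl (λ ()))

odd-slot0 : ∀ p → ¬ 2 ∣ slot p 0
odd-slot0 p 2∣ = >⇒∤ (s≤s (s≤s z≤n)) (∣m+n∣m⇒∣n (subst (2 ∣_) (+-identityʳ (2 * p + 1)) 2∣) (m∣m*n p))

even-slot1 : ∀ p → 2 ∣ slot p 1
even-slot1 p = divides (suc p) (regroup p)
  where
  regroup : ∀ p → 2 * p + 1 + 1 ≡ suc p * 2
  regroup = solve-∀

odd-slot2 : ∀ p → ¬ 2 ∣ slot p 2
odd-slot2 p = subst (λ x → ¬ 2 ∣ x) (sym (slot-carry p 0)) (odd-slot0 (suc p))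

even-slot3 : ∀ p → 2 ∣ slot p 3
even-slot3 p = subst (2 ∣_) (sym (slot-carry p 1)) (even-slot1 (suc p))

count : ∀ {P : ℕ → Set} → Decidable P → List ℕ → ℕ
count P? xs = length (filter P? xs)

count-++ : ∀ {P : ℕ → Set} (P? : Decidable P) xs ys → count P? (xs ++ ys) ≡ count P? xs + count P? ys
count-++ P? xs ys = trans (cong length (filter-++ P? xs ys)) (length-++ (filter P? xs))

count-run-all : ∀ {P : ℕ → Set} (P? : Decidable P) k c e → (∀ p → P (slot p e)) → count P? (run k c e) ≡ c
count-run-all P? k c e always = trans (cong length (filter-all P? (run-All k c e always))) (length-run k c e)

count-run-none : ∀ {P : ℕ → Set} (P? : Decidable P) k c e → (∀ p → ¬ P (slot p e)) → count P? (run k c e) ≡ 0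
count-run-none P? k c e never = cong length (filter-none P? (run-All k c e never))

count-config : ∀ {P : ℕ → Set} (P? : Decidable P) c₀ c₁ c₂ c₃ → count P? (config c₀ c₁ c₂ c₃) ≡
  count P? (run 0 c₀ 0) + (count P? (run c₀ c₁ 1) + (count P? (run (c₀ + c₁) c₂ 2) + count P? (run (c₀ + c₁ + c₂) c₃ 3)))
count-config P? c₀ c₁ c₂ c₃ = begin
  count P? (config c₀ c₁ c₂ c₃)           ≡⟨ cong (count P?) (config-runs c₀ c₁ c₂ c₃) ⟩
  count P? (R₀ ++ R₁ ++ R₂ ++ R₃)          ≡⟨ count-++ P? R₀ _ ⟩
  count P? R₀ + count P? (R₁ ++ R₂ ++ R₃)  ≡⟨ cong (count P? R₀ +_) (count-++ P? R₁ _) ⟩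
  count P? R₀ + (count P? R₁ + count P? (R₂ ++ R₃))
    ≡⟨ cong (λ r → count P? R₀ + (count P? R₁ + r)) (count-++ P? R₂ R₃) ⟩
  count P? R₀ + (count P? R₁ + (count P? R₂ + count P? R₃)) ∎
  where
  open ≡-Reasoning
  R₀ R₁ R₂ R₃ : List ℕ
  R₀ = run 0 c₀ 0
  R₁ = run c₀ c₁ 1
  R₂ = run (c₀ + c₁) c₂ 2
  R₃ = run (c₀ + c₁ + c₂) c₃ 3

evenCount-config : ∀ c₀ c₁ c₂ c₃ → evenCount (config c₀ c₁ c₂ c₃) ≡ c₁ + c₃
evenCount-config c₀ c₁ c₂ c₃ = trans (count-config (2 ∣?_) c₀ c₁ c₂ c₃)
  (cong₂ _+_ (count-run-none (2 ∣?_) 0 c₀ 0 odd-slot0)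
  (cong₂ _+_ (count-run-all (2 ∣?_) c₀ c₁ 1 even-slot1)
  (cong₂ _+_ (count-run-none (2 ∣?_) (c₀ + c₁) c₂ 2 odd-slot2)
             (count-run-all (2 ∣?_) (c₀ + c₁ + c₂) c₃ 3 even-slot3))))

oddCount-config : ∀ c₀ c₁ c₂ c₃ → count (λ x → ¬? (2 ∣? x)) (config c₀ c₁ c₂ c₃) ≡ c₀ + c₂
oddCount-config c₀ c₁ c₂ c₃ = trans (count-config odd? c₀ c₁ c₂ c₃)
  (trans (cong₂ _+_ (count-run-all odd? 0 c₀ 0 odd-slot0)
         (cong₂ _+_ (count-run-none odd? c₀ c₁ 1 (λ p odd → odd (even-slot1 p)))
         (cong₂ _+_ (count-run-all odd? (c₀ + c₁) c₂ 2 odd-slot2)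
                    (count-run-none odd? (c₀ + c₁ + c₂) c₃ 3 (λ p odd → odd (even-slot3 p))))))
         (cong (c₀ +_) (+-identityʳ c₂)))
  where
  odd? : Decidable (λ x → ¬ 2 ∣ x)
  odd? x = ¬? (2 ∣? x)

record IsConfig (n i : ℕ) (β : List ℕ) : Set where
  constructor isConfig
  field
    c₀ c₁ c₂ c₃ : ℕ
    stable      : c₀ ≡ 0 ⊎ c₃ ≡ 0
    size        : n ≡ c₀ + c₁ + c₂ + c₃
    evens       : i ≡ c₁ + c₃
    listing     : β ≡ config c₀ c₁ c₂ c₃

isConfig⇒inP : ∀ {n i β} → IsConfig n i β → InP n i β
isConfig⇒inP (isConfig c₀ c₁ c₂ c₃ stable refl refl refl) =
  ( Linked.map ≪⇒< chain
  , slotted-All n 0 _ (≤-reflexive (length-slackWord c₀ c₁ c₂ c₃))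
      (λ {p} {e} p<n e≤3 → slot-pos p e , slot-fits p<n e≤3)
      (slackWord-All c₀ c₁ c₂ c₃ (λ _ → z≤n) (s≤s z≤n) (s≤s (s≤s z≤n)) (λ _ → ≤-refl))
  , length-config c₀ c₁ c₂ c₃
  , (λ x∈ y∈ consecutive → ≪-no-successor chain x∈ y∈ (proj₁ consecutive))
  , config-avoids-ends c₀ c₁ c₂ c₃ stable )
  , evenCount-config c₀ c₁ c₂ c₃
  , trans (oddCount-config c₀ c₁ c₂ c₃) (sym odds)
  where
  n : ℕ
  n = c₀ + c₁ + c₂ + c₃
  chain : Linked _≪_ (config c₀ c₁ c₂ c₃)
  chain = config-≪ c₀ c₁ c₂ c₃
  regroup : c₀ + c₁ + c₂ + c₃ ≡ c₀ + c₂ + (c₁ + c₃)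
  regroup = solve (c₀ L.∷ c₁ L.∷ c₂ L.∷ c₃ L.∷ L.[])
  odds : n ∸ (c₁ + c₃) ≡ c₀ + c₂
  odds = trans (cong (_∸ (c₁ + c₃)) regroup) (m+n∸n≡m (c₀ + c₂) (c₁ + c₃))

-- Stable sets are configurations

stable-≪ : ∀ n β → Linked _<_ β → All (λ x → 1 ≤ x × x ≤ M n) β →
           (∀ {x y} → x ∈ β → y ∈ β → ¬ CycConsec n x y) → Linked _≪_ β
stable-≪ n []          _           _                   _        = []
stable-≪ n (x ∷ [])    _           _                   _        = [-]
stable-≪ n (x ∷ y ∷ β) (x<y ∷ inc) (x-in ∷ y-in ∷ rng) noConsec =
  ≤∧≢⇒< x<y (λ sx≡y → noConsec (here refl) (there (here refl)) (sym sx≡y , proj₁ x-in , x≤2n+1))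
  ∷ stable-≪ n (y ∷ β) inc (y-in ∷ rng) (λ x∈ y∈ → noConsec (there x∈) (there y∈))
  where
  x≤2n+1 : x ≤ 2 * n + 1
  x≤2n+1 = subst (x ≤_) (+-comm 1 (2 * n)) (≤-pred (≤-trans x<y (proj₂ y-in)))

≪-span : ∀ {N} b bs → Linked _≪_ (b ∷ bs) → All (_≤ N) (b ∷ bs) → b + 2 * length bs ≤ N
≪-span {N} b []        _             (b≤N ∷ _) = subst (_≤ N) (sym (+-identityʳ b)) b≤N
≪-span {N} b (b′ ∷ bs) (b≪b′ ∷ chain) (_ ∷ bounded) = begin
  b + 2 * suc (length bs)  ≡⟨ regroup b (length bs) ⟩
  2 + b + 2 * length bs    ≤⟨ +-monoˡ-≤ (2 * length bs) b≪b′ ⟩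
  b′ + 2 * length bs       ≤⟨ ≪-span b′ bs chain bounded ⟩
  N                        ∎
  where
  open ≤-Reasoning
  regroup : ∀ b L → b + 2 * suc L ≡ 2 + b + 2 * L
  regroup = solve-∀

≪-first : ∀ n k b bs → Linked _≪_ (b ∷ bs) → All (_≤ M n) (b ∷ bs) → k + length (b ∷ bs) ≡ n → b ≤ slot k 3
≪-first n k b bs chain bounded len =
  +-cancelʳ-≤ (2 * length bs) b (slot k 3) (subst (b + 2 * length bs ≤_) room (≪-span b bs chain bounded))
  where
  regroup : ∀ k L → 2 + 2 * (k + suc L) ≡ 2 * k + 1 + 3 + 2 * L
  regroup = solve-∀
  room : M n ≡ slot k 3 + 2 * length bs
  room = trans (cong M (sym len)) (regroup k (length bs))

unslot : ∀ n k β → Linked _≪_ β → All (2 * k + 1 ≤_) β → All (_≤ M n) β → k + length β ≡ n →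
         ∃[ es ] β ≡ slotted k es × All (_≤ 3) es
unslot n k []       _     _        _       _   = [] , refl , []
unslot n k (b ∷ bs) chain (lo ∷ _) bounded len =
  prepend (unslot n (suc k) bs (Linked.tail chain) above (All.tail bounded) (trans (sym (+-suc k (length bs))) len))
  where
  e : ℕ
  e = b ∸ (2 * k + 1)
  b≡ : b ≡ slot k e
  b≡ = sym (m+[n∸m]≡n lo)
  e≤3 : e ≤ 3
  e≤3 = +-cancelˡ-≤ (2 * k + 1) e 3 (subst (_≤ slot k 3) b≡ (≪-first n k b bs chain bounded len))
  above : All (2 * suc k + 1 ≤_) bs
  above = All.map (λ b≪x → ≤-trans (≤-reflexive (cong (_+ 1) (*-suc 2 k))) (≤-trans (+-monoʳ-≤ 2 lo) b≪x))
                  (≪-head chain)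
  prepend : ∃[ es ] bs ≡ slotted (suc k) es × All (_≤ 3) es → ∃[ es ] b ∷ bs ≡ slotted k es × All (_≤ 3) es
  prepend (es , bs≡ , es≤3) = e ∷ es , cong₂ _∷_ b≡ bs≡ , e≤3 ∷ es≤3

peel : ∀ v es → Linked _≤_ es → All (v ≤_) es →
       ∃[ c ] ∃[ rest ] es ≡ replicate c v ++ rest × Linked _≤_ rest × All (suc v ≤_) rest
peel v []       _      _            = 0 , [] , refl , [] , []
peel v (e ∷ es) sorted (v≤e ∷ v≤es) with e ≟ v
... | no e≢v = 0 , e ∷ es , refl , sorted , Linked⇒All ≤-trans (≤∧≢⇒< v≤e (e≢v ∘ sym)) sorted
... | yes refl with peel v es (Linked.tail sorted) v≤es
...   | c , rest , es≡ , sorted′ , above = suc c , rest , cong (v ∷_) es≡ , sorted′ , above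

pinned : ∀ {v} xs → All (v ≤_) xs → All (_≤ v) xs → xs ≡ replicate (length xs) v
pinned []       _          _          = refl
pinned (x ∷ xs) (v≤x ∷ lo) (x≤v ∷ hi) = cong₂ _∷_ (≤-antisym x≤v v≤x) (pinned xs lo hi)

sorted⇒slackWord : ∀ es → Linked _≤_ es → All (_≤ 3) es →
                   ∃[ c₀ ] ∃[ c₁ ] ∃[ c₂ ] ∃[ c₃ ] es ≡ slackWord c₀ c₁ c₂ c₃
sorted⇒slackWord es sorted ≤3 with peel 0 es sorted (All.universal (λ _ → z≤n) es)
... | c₀ , r₀ , refl , s₀ , a₀ with peel 1 r₀ s₀ a₀
... | c₁ , r₁ , refl , s₁ , a₁ with peel 2 r₁ s₁ a₁
... | c₂ , r₂ , refl , _  , a₂ = c₀ , c₁ , c₂ , length r₂ ,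
  cong (λ r → replicate c₀ 0 ++ replicate c₁ 1 ++ replicate c₂ 2 ++ r)
       (pinned r₂ a₂ (AllP.++⁻ʳ (replicate c₂ 2) (AllP.++⁻ʳ (replicate c₁ 1) (AllP.++⁻ʳ (replicate c₀ 0) ≤3))))

stable-slacks : ∀ {n β} → IsStable n β → ∃[ es ] β ≡ slotted 0 es × Linked _≤_ es × All (_≤ 3) es
stable-slacks {n} {β} (increasing , ranges , len , noConsec , _) =
  withOrder (unslot n 0 β chain (All.map proj₁ ranges) (All.map proj₂ ranges) len)
  where
  chain : Linked _≪_ β
  chain = stable-≪ n β increasing ranges noConsec
  withOrder : ∃[ es ] β ≡ slotted 0 es × All (_≤ 3) es → ∃[ es ] β ≡ slotted 0 es × Linked _≤_ es × All (_≤ 3) es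
  withOrder (es , β≡ , es≤3) = es , β≡ , ≪-slotted 0 es (subst (Linked _≪_) β≡ chain) , es≤3

run-last : ∀ k c e → slot (k + c) e ∈ run k (suc c) e
run-last k zero    e = here (cong (λ p → slot p e) (+-identityʳ k))
run-last k (suc c) e = there (subst (λ p → slot p e ∈ run (suc k) (suc c) e) (sym (+-suc k c)) (run-last (suc k) c e))

top∈config : ∀ c₀ c₁ c₂ c₃ → M (c₀ + c₁ + c₂ + suc c₃) ∈ config c₀ c₁ c₂ (suc c₃)
top∈config c₀ c₁ c₂ c₃ = subst₂ _∈_ (regroup (c₀ + c₁ + c₂) c₃) (sym (config-runs c₀ c₁ c₂ (suc c₃)))
  (∈-++⁺ʳ (run 0 c₀ 0) (∈-++⁺ʳ (run c₀ c₁ 1) (∈-++⁺ʳ (run (c₀ + c₁) c₂ 2) (run-last (c₀ + c₁ + c₂) c₃ 3))))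
  where
  regroup : ∀ K c → 2 * (K + c) + 1 + 3 ≡ 2 + 2 * (K + suc c)
  regroup = solve-∀

config-stable : ∀ {n} c₀ c₁ c₂ c₃ → n ≡ c₀ + c₁ + c₂ + c₃ →
                ¬ (1 ∈ config c₀ c₁ c₂ c₃ × M n ∈ config c₀ c₁ c₂ c₃) → c₀ ≡ 0 ⊎ c₃ ≡ 0
config-stable zero     c₁ c₂ c₃       _    _        = inj₁ refl
config-stable (suc c₀) c₁ c₂ zero     _    _        = inj₂ refl
config-stable (suc c₀) c₁ c₂ (suc c₃) refl not-both = ⊥-elim (not-both (here refl , top∈config (suc c₀) c₁ c₂ c₃))

inP⇒isConfig : ∀ {n i β} → InP n i β → IsConfig n i β
inP⇒isConfig {n} (stable@(_ , _ , len , _ , not-both) , evens , _) with stable-slacks stable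
... | es , refl , sorted , es≤3 with sorted⇒slackWord es sorted es≤3
... | c₀ , c₁ , c₂ , c₃ , refl = isConfig c₀ c₁ c₂ c₃ (config-stable c₀ c₁ c₂ c₃ size not-both) size
  (trans (sym evens) (evenCount-config c₀ c₁ c₂ c₃)) refl
  where
  size : n ≡ c₀ + c₁ + c₂ + c₃
  size = trans (sym len) (length-config c₀ c₁ c₂ c₃)

-- The sets αʲ as configurations

applyUpTo-run : ∀ (f : ℕ → ℕ) k c e → (∀ p → f p ≡ slot (k + p) e) → applyUpTo f c ≡ run k c e
applyUpTo-run f k zero    e f≡ = refl
applyUpTo-run f k (suc c) e f≡ = cong₂ _∷_ (trans (f≡ 0) (cong (λ q → slot q e) (+-identityʳ k)))
  (applyUpTo-run (f ∘ suc) (suc k) c e (λ p → trans (f≡ (suc p)) (cong (λ q → slot q e) (+-suc k p))))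

alpha0-runs : ∀ m i → alpha0 (m + i) i ≡ run 0 m 0 ++ run m i 1
alpha0-runs m i = begin
  alpha0 (m + i) i
    ≡⟨ cong (λ z → map (λ k → 2 * k + 1) (upTo z) ++ map (λ k → 2 * z + 2 + 2 * k) (upTo i)) (m+n∸n≡m m i) ⟩
  map (λ k → 2 * k + 1) (upTo m) ++ map (λ k → 2 * m + 2 + 2 * k) (upTo i)
    ≡⟨ cong₂ _++_ (trans (map-applyUpTo (λ k → k) _ m) (applyUpTo-run _ 0 m 0 (λ p → sym (+-identityʳ (2 * p + 1)))))
                  (trans (map-applyUpTo (λ k → k) _ i) (applyUpTo-run _ m i 1 (regroup m))) ⟩
  run 0 m 0 ++ run m i 1 ∎
  where
  open ≡-Reasoning
  regroup : ∀ m p → 2 * m + 2 + 2 * p ≡ 2 * (m + p) + 1 + 1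
  regroup = solve-∀

-- For j ≤ n - i, writing n = a + j + i: the first j odd entries of α⁰ wrap
-- around to slack 2 at the end, the rest move down by 2j, so αʲ = (a, i, j, 0).
alpha-early : ∀ {n i j} a → n ≡ a + j + i → alpha n i j ≡ config a i j 0
alpha-early {i = i} {j} a refl = sort-unique _ _ rotation (config-sorted a i j 0)
  where
  open ≡-Reasoning
  f : ℕ → ℕ
  f = shiftElt (a + j + i) (2 * j)
  R₁ R₂ R₃ : List ℕ
  R₁ = run (a + i) j 2
  R₂ = run 0 a 0
  R₃ = run a i 1
  source : alpha0 (a + j + i) i ≡ run 0 j 0 ++ run j a 0 ++ run (j + a) i 1
  source = begin
    alpha0 (a + j + i) i                        ≡⟨ cong (λ z → alpha0 (z + i) i) (+-comm a j) ⟩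
    alpha0 (j + a + i) i                        ≡⟨ alpha0-runs (j + a) i ⟩
    run 0 (j + a) 0 ++ run (j + a) i 1          ≡⟨ cong (_++ run (j + a) i 1) (run-split 0 j a 0) ⟩
    (run 0 j 0 ++ run j a 0) ++ run (j + a) i 1 ≡⟨ ++-assoc (run 0 j 0) (run j a 0) (run (j + a) i 1) ⟩
    run 0 j 0 ++ run j a 0 ++ run (j + a) i 1   ∎
  image : map f (alpha0 (a + j + i) i) ≡ R₁ ++ R₂ ++ R₃
  image = trans (cong (map f) source) (map-++₃ f
    (shift-run (a + j + i) (2 * j) 1 {0} {a + i} {0} {2} j (s≤s (s≤s z≤n))
      (≤-by 0 (solve (a L.∷ j L.∷ i L.∷ L.[]))) (solve (a L.∷ j L.∷ i L.∷ L.[])))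
    (shift-run (a + j + i) (2 * j) 0 {j} {0} {0} {0} a z≤n
      (≤-by (j + i) (solve (a L.∷ j L.∷ i L.∷ L.[]))) (solve (a L.∷ j L.∷ i L.∷ L.[])))
    (shift-run (a + j + i) (2 * j) 0 {j + a} {a} {1} {1} i (s≤s z≤n)
      (≤-by j (solve (a L.∷ j L.∷ i L.∷ L.[]))) (solve (a L.∷ j L.∷ i L.∷ L.[]))))
  target : config a i j 0 ≡ R₂ ++ R₃ ++ R₁
  target = trans (config-runs a i j 0) (cong (λ r → R₂ ++ R₃ ++ r) (++-identityʳ R₁))
  rotation : map f (alpha0 (a + j + i) i) ↭ config a i j 0
  rotation = subst₂ _↭_ (sym image) (sym target)
    (↭-trans (Perm.++-comm R₁ (R₂ ++ R₃)) (↭-reflexive (++-assoc R₂ R₃ R₁)))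

-- For j = m + t ≥ m = n - i, writing i = a + t: all m odd entries and the
-- first t even entries wrap around (to slacks 2 and 3), the remaining a even
-- entries move to the front, so αʲ = (0, a, m, t).
alpha-late : ∀ {n i j} m a t → n ≡ m + i → i ≡ a + t → j ≡ m + t → alpha n i j ≡ config 0 a m t
alpha-late m a t refl refl refl = sort-unique _ _ rotation (config-sorted 0 a m t)
  where
  f : ℕ → ℕ
  f = shiftElt (m + (a + t)) (2 * (m + t))
  R₁ R₂ R₃ : List ℕ
  R₁ = run a m 2
  R₂ = run (a + m) t 3
  R₃ = run 0 a 1
  source : alpha0 (m + (a + t)) (a + t) ≡ run 0 m 0 ++ run m t 1 ++ run (m + t) a 1
  source = trans (alpha0-runs m (a + t))
    (cong (run 0 m 0 ++_) (trans (cong (λ c → run m c 1) (+-comm a t)) (run-split m t a 1)))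
  image : map f (alpha0 (m + (a + t)) (a + t)) ≡ R₁ ++ R₂ ++ R₃
  image = trans (cong (map f) source) (map-++₃ f
    (shift-run (m + (a + t)) (2 * (m + t)) 1 {0} {a} {0} {2} m (s≤s (s≤s z≤n))
      (≤-by t (solve (m L.∷ a L.∷ t L.∷ L.[]))) (solve (m L.∷ a L.∷ t L.∷ L.[])))
    (shift-run (m + (a + t)) (2 * (m + t)) 1 {m} {a + m} {1} {3} t ≤-refl
      (≤-by 0 (solve (m L.∷ a L.∷ t L.∷ L.[]))) (solve (m L.∷ a L.∷ t L.∷ L.[])))
    (shift-run (m + (a + t)) (2 * (m + t)) 0 {m + t} {0} {1} {1} a (s≤s z≤n)
      (≤-by (m + t) (solve (m L.∷ a L.∷ t L.∷ L.[]))) (solve (m L.∷ a L.∷ t L.∷ L.[]))))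
  rotation : map f (alpha0 (m + (a + t)) (a + t)) ↭ config 0 a m t
  rotation = subst₂ _↭_ (sym image) (sym (config-runs 0 a m t))
    (↭-trans (↭-reflexive (sym (++-assoc R₁ R₂ R₃))) (Perm.++-comm (R₁ ++ R₂) R₃))

-- Shifting (0, 0, m, i) by 2 moves every entry down by 2 without wrapping,
-- turning the slacks 2, 3 into 0, 1.
config-wrap : ∀ {n} m i → n ≡ m + i → shiftSet n (config 0 0 m i) 2 ≡ config m i 0 0
config-wrap m i refl = sort-unique _ _ (↭-reflexive image) (config-sorted m i 0 0)
  where
  f : ℕ → ℕ
  f = shiftElt (m + i) 2
  image : map f (config 0 0 m i) ≡ config m i 0 0
  image = trans (cong (map f) (config-runs 0 0 m i))
    (trans (map-++ f (run 0 m 2) (run m i 3))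
    (trans (cong₂ _++_
      (shift-run (m + i) 2 0 {0} {0} {2} {0} m z≤n
        (≤-by i (solve (m L.∷ i L.∷ L.[]))) (solve (m L.∷ i L.∷ L.[])))
      (shift-run (m + i) 2 0 {m} {m} {3} {1} i (s≤s z≤n)
        (≤-by 0 (solve (m L.∷ i L.∷ L.[]))) (solve (m L.∷ i L.∷ L.[]))))
    (sym (trans (config-runs m i 0 0) (cong (run 0 m 0 ++_) (++-identityʳ (run m i 1)))))))

-- Every αʲ with j ≤ n is an admissible configuration.  Write n = i + m;
-- for j ≤ m, j + a = m gives (a, i, j, 0); otherwise j = m + t with
-- t + a = i gives (0, a, m, t).
alpha-isConfig : ∀ {n i j} → i ≤ n → j ≤ n → IsConfig n i (alpha n i j)
alpha-isConfig {i = i} {j} i≤n j≤n with m≤n⇒∃[o]m+o≡n i≤n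
... | m , refl with j ≤? m
...   | yes j≤m with m≤n⇒∃[o]m+o≡n j≤m
...     | a , refl = isConfig a i j 0 (inj₂ refl) (solve (i L.∷ j L.∷ a L.∷ L.[])) (sym (+-identityʳ i))
                       (alpha-early {i = i} {j} a (solve (i L.∷ j L.∷ a L.∷ L.[])))
alpha-isConfig {i = i} {j} i≤n j≤n
      | m , refl | no j≰m with m≤n⇒∃[o]m+o≡n (<⇒≤ (≰⇒> j≰m))
...     | t , refl with m≤n⇒∃[o]m+o≡n (+-cancelˡ-≤ m t i (subst (m + t ≤_) (+-comm i m) j≤n))
...       | a , refl = isConfig 0 a m t (inj₁ refl) (solve (m L.∷ t L.∷ a L.∷ L.[])) (+-comm t a)
                         (alpha-late m a t (+-comm (t + a) m) (+-comm t a) refl)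

isConfig⇒alpha : ∀ {n i β} → IsConfig n i β → ∃[ j ] j ≤ n × β ≡ alpha n i j
isConfig⇒alpha (isConfig zero c₁ c₂ c₃ _ refl refl refl) =
  c₂ + c₃ , ≤-by c₁ (solve (c₁ L.∷ c₂ L.∷ c₃ L.∷ L.[])) ,
  sym (alpha-late {i = c₁ + c₃} c₂ c₁ c₃ (solve (c₁ L.∷ c₂ L.∷ c₃ L.∷ L.[])) refl refl)
isConfig⇒alpha (isConfig c₀ c₁ c₂ zero _ refl refl refl) =
  c₂ , ≤-by (c₀ + c₁) (solve (c₀ L.∷ c₁ L.∷ c₂ L.∷ L.[])) ,
  sym (trans (alpha-early {i = c₁ + 0} {c₂} c₀ (solve (c₀ L.∷ c₁ L.∷ c₂ L.∷ L.[])))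
             (cong (λ c → config c₀ c c₂ 0) (+-identityʳ c₁)))
isConfig⇒alpha (isConfig (suc _) _ _ (suc _) (inj₁ ()) _ _ _)
isConfig⇒alpha (isConfig (suc _) _ _ (suc _) (inj₂ ()) _ _ _)

-- αⁿ ⊖ 2 = α⁰: αⁿ = (0, 0, n-i, i) and α⁰ = (n-i, i, 0, 0).
alpha-wrap : ∀ {n i} → i ≤ n → shiftSet n (alpha n i n) 2 ≡ alpha n i 0
alpha-wrap {i = i} i≤n with m≤n⇒∃[o]m+o≡n i≤n
... | m , refl = begin
  shiftSet (i + m) (alpha (i + m) i (i + m)) 2
    ≡⟨ cong (λ β → shiftSet (i + m) β 2) (alpha-late m 0 i (+-comm i m) refl (+-comm i m)) ⟩
  shiftSet (i + m) (config 0 0 m i) 2 ≡⟨ config-wrap m i (+-comm i m) ⟩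
  config m i 0 0                      ≡⟨ sym (alpha-early {i = i} {0} m (solve (i L.∷ m L.∷ L.[]))) ⟩
  alpha (i + m) i 0                   ∎
  where open ≡-Reasoning

-- The lexicographic order

lex-slotted : ∀ k {es es′} → Lex-< _≡_ _<_ es es′ → LexLt (slotted k es) (slotted k es′)
lex-slotted k {[]}    {[]}     (base ())
lex-slotted k {[]}    {_ ∷ _}  halt         = halt
lex-slotted k {e ∷ _} {e′ ∷ _} (this e<e′)  = this (+-monoʳ-< (2 * k + 1) e<e′)
lex-slotted k {e ∷ _} {e′ ∷ _} (next refl l) = next refl (lex-slotted (suc k) l)

lex-replicate : ∀ a {v w} xs ys → v < w → Lex-< _≡_ _<_ (replicate (suc a) v ++ xs) (replicate a v ++ w ∷ ys)
lex-replicate zero    xs ys v<w = this v<w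
lex-replicate (suc a) xs ys v<w = next refl (lex-replicate a xs ys v<w)

-- Below n - i, the step j ↦ j+1 moves a letter from the 0-run to the 2-run;
-- the first changed letter is a 0 that grows (to 1, or to 2 when i = 0).
lex-early : ∀ a i j → LexLt (config (suc a) i j 0) (config a i (suc j) 0)
lex-early a zero    j = lex-slotted 0 (lex-replicate a _ _ (s≤s z≤n))
lex-early a (suc i) j = lex-slotted 0 (lex-replicate a _ _ (s≤s z≤n))

-- Above n - i, the step j ↦ j+1 moves a letter from the 1-run to the 3-run;
-- the first changed letter is a 1 that grows (to 2, or to 3 when m = 0).
lex-late : ∀ a m t → LexLt (config 0 (suc a) m t) (config 0 a m (suc t))
lex-late a zero    t = lex-slotted 0 (lex-replicate a _ _ (s≤s (s≤s z≤n)))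
lex-late a (suc m) t = lex-slotted 0 (lex-replicate a _ _ (s≤s (s≤s z≤n)))

-- Consecutive αʲ increase: j and j+1 lie on the same side of n - i
-- (j+1 ≤ n - i, or j ≥ n - i), where the two steps above apply.
alpha-lex : ∀ {n i j} → i ≤ n → j < n → LexLt (alpha n i j) (alpha n i (suc j))
alpha-lex {i = i} {j} i≤n j<n with m≤n⇒∃[o]m+o≡n i≤n
... | m , refl with suc j ≤? m
...   | yes j<m with m≤n⇒∃[o]m+o≡n j<m
...     | a , refl = subst₂ LexLt
          (sym (alpha-early {i + (suc j + a)} {i} {j} (suc a) (solve (i L.∷ j L.∷ a L.∷ L.[]))))
          (sym (alpha-early {i + (suc j + a)} {i} {suc j} a (solve (i L.∷ j L.∷ a L.∷ L.[]))))
          (lex-early a i j)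
alpha-lex {i = i} {j} i≤n j<n
      | m , refl | no j≮m with m≤n⇒∃[o]m+o≡n (≤-pred (≰⇒> j≮m))
...     | t , refl with m≤n⇒∃[o]m+o≡n (+-cancelˡ-≤ m (suc t) i (subst₂ _≤_ (sym (+-suc m t)) (+-comm i m) j<n))
...       | a , refl = subst₂ LexLt
          (sym (alpha-late {i = suc t + a} m (suc a) t (+-comm (suc t + a) m) (solve (t L.∷ a L.∷ L.[])) refl))
          (sym (alpha-late m a (suc t) (+-comm (suc t + a) m) (+-comm (suc t) a) (sym (+-suc m t))))
          (lex-late a m t)

mainTheorem4 : (n i : ℕ) → 1 ≤ n → i ≤ n →
    ((β : List ℕ) → (InP n i β → ∃[ j ] (j ≤ n × β ≡ alpha n i j))
                  × ((j : ℕ) → j ≤ n → β ≡ alpha n i j → InP n i β))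
    × ((j : ℕ) → j < n → LexLt (alpha n i j) (alpha n i (suc j)))
    × (shiftSet n (alpha n i n) 2 ≡ alpha n i 0)
mainTheorem4 n i _ i≤n =
  (λ β → (λ β∈Pᵢ → isConfig⇒alpha (inP⇒isConfig β∈Pᵢ))
       , (λ j j≤n β≡αʲ → subst (InP n i) (sym β≡αʲ) (isConfig⇒inP (alpha-isConfig i≤n j≤n))))
  , (λ j j<n → alpha-lex i≤n j<n)
  , alpha-wrap i≤n
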